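{- Let $(X,\tau)$ be a $T_d$-space with derivative operator $d=d_\tau$. If a point $x\in X$ is doubly $d$-reflexive, then $x$ is $m$-fold $d$-reflexive for every finite $m\geq 1$.
   Context: For $A\subseteq X$, $d(A)$ is the set of limit points of $A$ (points $x$ every open neighbourhood of which contains a point of $A$ other than $x$). $(X,\tau)$ is a $T_d$-space if $d(A)$ is closed for every $A\subseteq X$. A point $a\in X$ is $m$-fold $d$-reflexive if $a\in d(X)$ and for all $A_1,\dots,A_m\subseteq X$, $a\in dA_1\cap\dots\cap dA_m$ implies $a\in d(dA_1\cap\dots\cap dA_m)$. Doubly $d$-reflexive means $2$-fold $d$-reflexive. -}

module Defs where

open import Level using (0ℓ)
open import Data.Nat using (ℕ; _≥_)
open import Data.Fin using (Fin)
open import Data.Product using (Σ; ∃; _×_; _,_)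
open import Data.Empty using (⊥)
open import Relation.Unary using (Pred; _⊆_; ∁; _∩_; U; ∅; _∈_)
open import Relation.Binary.PropositionalEquality using (_≡_)
open import Relation.Nullary using (¬_)

-- To keep everything in Set, the open
-- sets are given by an index type Open with an extension map ⟦_⟧; the
-- subsets that are open are exactly those extensionally equal to some ⟦ o ⟧.
record Topology (X : Set) : Set₁ where
  field
    Open   : Set
    ⟦_⟧    : Open → Pred X 0ℓ

  IsOpen : Pred X 0ℓ → Set
  IsOpen A = ∃ λ o → (⟦ o ⟧ ⊆ A) × (A ⊆ ⟦ o ⟧)

  field
    empty-open  : IsOpen ∅
    univ-open   : IsOpen U
    ∩-open      : (o o′ : Open) → IsOpen (⟦ o ⟧ ∩ ⟦ o′ ⟧)
    ⋃-open      : {I : Set} (V : I → Open) →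
                  IsOpen (λ x → ∃ λ i → x ∈ ⟦ V i ⟧)

module _ {X : Set} (τ : Topology X) where
  open Topology τ

  IsClosed : Pred X 0ℓ → Set
  IsClosed A = IsOpen (∁ A)

  d : Pred X 0ℓ → Pred X 0ℓ
  d A x = (o : Open) → x ∈ ⟦ o ⟧ →
          ∃ λ y → y ∈ ⟦ o ⟧ × y ∈ A × ¬ (y ≡ x)

  IsTd : Set₁
  IsTd = (A : Pred X 0ℓ) → IsClosed (d A)

  ⋂d : {m : ℕ} → (Fin m → Pred X 0ℓ) → Pred X 0ℓ
  ⋂d A x = ∀ i → d (A i) x

  MFoldDReflexive : ℕ → X → Set₁
  MFoldDReflexive m a =
    d U a × ((A : Fin m → Pred X 0ℓ) → ⋂d A a → d (⋂d A) a)

  DoublyDReflexive : X → Set₁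
  DoublyDReflexive = MFoldDReflexive 2

-- The only topological input is that in a T_d-space the derived set of a
-- derived set shrinks: d(d A) ⊆ d A (a point outside the closed set d A has a
-- neighbourhood missing d A, so it is not a limit point of d A; this step uses
-- excluded middle).  Since d is monotone, it follows that
-- d(dA₁ ∩ … ∩ dAₘ) ⊆ dA₁ ∩ … ∩ dAₘ.
--
-- The theorem is then an induction on m.  For m = 0 the claim is x ∈ d X,
-- part of being d-reflexive.  For m + 1, writing B = dA₂ ∩ … ∩ dAₘ₊₁, the
-- induction hypothesis gives x ∈ d B; double reflexivity applied to the pair
-- (B, A₁) gives x ∈ d(d B ∩ d A₁), and d B ∩ d A₁ ⊆ B ∩ d A₁ = dA₁ ∩ … ∩ dAₘ₊₁
-- by the shrinking property, so monotonicity of d finishes the step.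
module Submission where

open import Defs
open import Level using (0ℓ)
open import Data.Nat using (ℕ; _≥_; zero; suc)
open import Data.Fin using (Fin; zero; suc)
open import Data.Product using (_,_; proj₁)
open import Data.Empty using (⊥-elim)
open import Relation.Nullary using (yes; no)
open import Relation.Unary using (Pred; _⊆_)
open import Axiom.ExcludedMiddle using (ExcludedMiddle)

module _ {X : Set} (τ : Topology X) where
  open Topology τ

  d-mono : {A B : Pred X 0ℓ} → A ⊆ B → d τ A ⊆ d τ B
  d-mono A⊆B x∈dA o x∈o with x∈dA o x∈o
  ... | y , y∈o , y∈A , y≢x = y , y∈o , A⊆B y∈A , y≢x

  pair : Pred X 0ℓ → Pred X 0ℓ → Fin 2 → Pred X 0ℓ
  pair P Q zero    = P
  pair P Q (suc _) = Q

  module _ (em : ExcludedMiddle 0ℓ) (td : IsTd τ) where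

    -- In a T_d-space derived sets are closed, hence contain their limit
    -- points: a point outside d A has an open neighbourhood disjoint from d A.
    dd⊆d : (A : Pred X 0ℓ) → d τ (d τ A) ⊆ d τ A
    dd⊆d A {x} x∈ddA with em {d τ A x}
    ... | yes x∈dA = x∈dA
    ... | no x∉dA with td A
    ...   | o , o⊆∁dA , ∁dA⊆o with x∈ddA o (∁dA⊆o x∉dA)
    ...     | y , y∈o , y∈dA , _ = ⊥-elim (o⊆∁dA y∈o y∈dA)

    d⋂d⊆⋂d : {m : ℕ} (A : Fin m → Pred X 0ℓ) → d τ (⋂d τ A) ⊆ ⋂d τ A
    d⋂d⊆⋂d A y∈d⋂ i = dd⊆d (A i) (d-mono (λ z∈⋂ → z∈⋂ i) y∈d⋂)

    ⋂d-pair⊆⋂d : {m : ℕ} (A : Fin (suc m) → Pred X 0ℓ) →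
                 ⋂d τ (pair (⋂d τ (λ j → A (suc j))) (A zero)) ⊆ ⋂d τ A
    ⋂d-pair⊆⋂d A y∈⋂ zero    = y∈⋂ (suc zero)
    ⋂d-pair⊆⋂d A y∈⋂ (suc j) = d⋂d⊆⋂d (λ j → A (suc j)) (y∈⋂ zero) j

    doubly⇒reflexive : (x : X) → DoublyDReflexive τ x →
                       (m : ℕ) (A : Fin m → Pred X 0ℓ) →
                       ⋂d τ A x → d τ (⋂d τ A) x
    doubly⇒reflexive x (x∈dX , _) zero A _ = d-mono (λ _ ()) x∈dX
    doubly⇒reflexive x dr@(_ , reflexive₂) (suc m) A x∈⋂ =
      d-mono (⋂d-pair⊆⋂d A) (reflexive₂ (pair tail (A zero)) x∈⋂pair)
      where
        tail : Pred X 0ℓ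
        tail = ⋂d τ (λ j → A (suc j))

        x∈⋂pair : ⋂d τ (pair tail (A zero)) x
        x∈⋂pair zero    = doubly⇒reflexive x dr m (λ j → A (suc j))
                                            (λ j → x∈⋂ (suc j))
        x∈⋂pair (suc _) = x∈⋂ zero

mainTheorem3 : ExcludedMiddle 0ℓ →
    {X : Set} (τ : Topology X) → IsTd τ →
    (x : X) → DoublyDReflexive τ x →
    (m : ℕ) → m ≥ 1 → MFoldDReflexive τ m x
mainTheorem3 em τ td x dr m _ =
  proj₁ dr , doubly⇒reflexive τ em td x dr m
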